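{- Let $G=(U,W,E)$ be a convex bipartite graph with $|U|\ge 2$ and $|W|\ge 2$, with convex ordering $w_1,\dots,w_{|W|}$ of $W$, and let $D$ be a minimal connected dominating set of $G$. If $i,j\in U$ are distinct vertices with $r(I_i)=r(I_j)$ or $l(I_i)=l(I_j)$, then $|\{i,j\}\cap D|\le 1$.
   Context: All graphs are finite, undirected, simple. A bipartite graph $G=(U,W,E)$ is convex if there is an ordering $w_1,\dots,w_{|W|}$ of $W$ such that for every $u\in U$ the neighborhood $N(u)\subseteq W$ is a set of consecutive vertices $I_u=\{w_a,w_{a+1},\dots,w_b\}$ in this ordering (the neighbor interval of $u$), with left endpoint $l(I_u)=w_a$ and right endpoint $r(I_u)=w_b$. A set $D\subseteq V(G)$ is a connected dominating set if $G[D]$ is connected and every vertex of $G$ is in $D$ or has a neighbor in $D$; it is minimal if no proper subset of it is a connected dominating set. -}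

module Defs where

open import Data.Nat using (ℕ)
open import Data.Fin using (Fin; _≤_)
open import Data.Bool using (Bool; true; false)
open import Data.Sum using (_⊎_; inj₁; inj₂)
open import Data.Product using (_×_; Σ; ∃)
open import Data.Empty using (⊥)
open import Relation.Binary.PropositionalEquality using (_≡_)

-- A bipartite graph G = (U, W, E) with U = Fin m, W = Fin n.
-- The given ordering w_1, ..., w_n of W is the natural order of Fin n.
-- E u w ≡ true  iff  u ∈ U is adjacent to w ∈ W.
BipEdges : ℕ → ℕ → Set
BipEdges m n = Fin m → Fin n → Bool

IsConvex : ∀ {m n} → BipEdges m n → Set
IsConvex {m} {n} E =
  ∀ (u : Fin m) (a b c : Fin n) → a ≤ b → b ≤ c →
    E u a ≡ true → E u c ≡ true → E u b ≡ true

IsRightEnd : ∀ {m n} → BipEdges m n → Fin m → Fin n → Set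
IsRightEnd E u w = E u w ≡ true × (∀ w' → E u w' ≡ true → w' ≤ w)

IsLeftEnd : ∀ {m n} → BipEdges m n → Fin m → Fin n → Set
IsLeftEnd E u w = E u w ≡ true × (∀ w' → E u w' ≡ true → w ≤ w')

Vertex : ℕ → ℕ → Set
Vertex m n = Fin m ⊎ Fin n

Adj : ∀ {m n} → BipEdges m n → Vertex m n → Vertex m n → Set
Adj E (inj₁ u) (inj₁ u') = ⊥
Adj E (inj₁ u) (inj₂ w) = E u w ≡ true
Adj E (inj₂ w) (inj₁ u) = E u w ≡ true
Adj E (inj₂ w) (inj₂ w') = ⊥

VSet : ℕ → ℕ → Set
VSet m n = Vertex m n → Bool

_∈ₛ_ : ∀ {m n} → Vertex m n → VSet m n → Set
v ∈ₛ D = D v ≡ true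

data PathIn {m n} (E : BipEdges m n) (D : VSet m n) : Vertex m n → Vertex m n → Set where
  here : ∀ {x} → x ∈ₛ D → PathIn E D x x
  step : ∀ {x y z} → x ∈ₛ D → Adj E x y → PathIn E D y z → PathIn E D x z

InducedConnected : ∀ {m n} → BipEdges m n → VSet m n → Set
InducedConnected E D = ∀ x y → x ∈ₛ D → y ∈ₛ D → PathIn E D x y

Dominating : ∀ {m n} → BipEdges m n → VSet m n → Set
Dominating E D = ∀ v → v ∈ₛ D ⊎ ∃ (λ v' → v' ∈ₛ D × Adj E v v')

IsCDS : ∀ {m n} → BipEdges m n → VSet m n → Set
IsCDS E D = InducedConnected E D × Dominating E D

ProperSubset : ∀ {m n} → VSet m n → VSet m n → Set
ProperSubset D' D = (∀ v → v ∈ₛ D' → v ∈ₛ D) × ∃ (λ v → v ∈ₛ D × D' v ≡ false)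

IsMinimalCDS : ∀ {m n} → BipEdges m n → VSet m n → Set
IsMinimalCDS E D = IsCDS E D × (∀ D' → ProperSubset D' D → IsCDS E D' → ⊥)

-- If two vertices i, j of U share a right (or left) endpoint, convexity forces
-- their neighbourhoods to be nested, say N(i) ⊆ N(j). Then i is redundant in any
-- connected dominating set D containing both: whatever i dominates is dominated
-- by j, and every walk in G[D] through w – i – w' can detour through w – j – w'.
-- So D minus i is a smaller connected dominating set, and D is not minimal.
module Submission where

open import Defs
open import Data.Nat using (ℕ; _≤_)
open import Data.Fin using (Fin)
open import Data.Sum using (_⊎_; inj₁; inj₂)
open import Data.Product using (_×_; ∃)
open import Relation.Nullary using (¬_)
open import Relation.Binary.PropositionalEquality using (_≡_)

open import Data.Bool using (true; false)
import Data.Bool.Properties as Bool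
open import Data.Empty using (⊥-elim)
import Data.Fin as Fin
import Data.Fin.Properties as Fin
open import Data.Product using (_,_; proj₁; proj₂)
open import Data.Sum.Properties using (≡-dec)
open import Function using (flip)
open import Relation.Binary using (Rel; Total; DecidableEquality)
open import Relation.Nullary using (yes; no; _×-dec_)
open import Relation.Binary.PropositionalEquality using (refl; sym; trans; ≢-sym)

_⊆ᴺ[_]_ : ∀ {m n} → Fin m → BipEdges m n → Fin m → Set
a ⊆ᴺ[ E ] b = ∀ w → E a w ≡ true → E b w ≡ true

module _ {m n ℓ} (_≼_ : Rel (Fin n) ℓ) (E : BipEdges m n) where

  ConvexWrt : Set ℓ
  ConvexWrt = ∀ u a b c → a ≼ b → b ≼ c → E u a ≡ true → E u c ≡ true → E u b ≡ true

  IsMaximumWrt : Fin m → Fin n → Set ℓ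
  IsMaximumWrt u w = E u w ≡ true × (∀ w' → E u w' ≡ true → w' ≼ w)

  -- A witness x ∈ N(a) ∖ N(b) lies below the common maximum, and convexity of
  -- N(b) then forbids any neighbour of b below x; so N(b) ⊆ [x, max] ⊆ N(a).
  sharedMaximum⇒nested : Total _≼_ → ConvexWrt → ∀ {a b w} → IsMaximumWrt a w → IsMaximumWrt b w →
    a ⊆ᴺ[ E ] b ⊎ b ⊆ᴺ[ E ] a
  sharedMaximum⇒nested ≼-total convex {a} {b} {w} (aw , a≼w) (bw , b≼w)
    with Fin.any? (λ x → (E a x Bool.≟ true) ×-dec (E b x Bool.≟ false))
  ... | no ∄x = inj₁ a⊆b
    where
    a⊆b : ∀ x → E a x ≡ true → E b x ≡ true
    a⊆b x ax with E b x in bx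
    ... | true  = refl
    ... | false = ⊥-elim (∄x (x , ax , bx))
  ... | yes (x , ax , bx) = inj₂ b⊆a
    where
    b⊆a : ∀ y → E b y ≡ true → E a y ≡ true
    b⊆a y by with ≼-total x y
    ... | inj₁ x≼y = convex a x y w x≼y (b≼w y by) ax aw
    ... | inj₂ y≼x with () ← trans (sym bx) (convex b y x w y≼x (a≼w x ax) by bw)

IsConvex⇒ConvexWrt-≥ : ∀ {m n} {E : BipEdges m n} → IsConvex E → ConvexWrt (flip Fin._≤_) E
IsConvex⇒ConvexWrt-≥ convex u a b c b≤a c≤b ua uc = convex u c b a c≤b b≤a uc ua

sharedEndpoint⇒nested : ∀ {m n} (E : BipEdges m n) → IsConvex E → ∀ {i j} →
  (∃ (λ w → IsRightEnd E i w × IsRightEnd E j w) ⊎ ∃ (λ w → IsLeftEnd E i w × IsLeftEnd E j w)) →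
  i ⊆ᴺ[ E ] j ⊎ j ⊆ᴺ[ E ] i
sharedEndpoint⇒nested E convex (inj₁ (_ , ri , rj)) =
  sharedMaximum⇒nested Fin._≤_ E Fin.≤-total convex ri rj
sharedEndpoint⇒nested E convex (inj₂ (_ , li , lj)) =
  sharedMaximum⇒nested (flip Fin._≤_) E (flip Fin.≤-total) (IsConvex⇒ConvexWrt-≥ convex) li lj

module _ {m n : ℕ} where

  _≟ᵛ_ : DecidableEquality (Vertex m n)
  _≟ᵛ_ = ≡-dec Fin._≟_ Fin._≟_

  _─_ : VSet m n → Vertex m n → VSet m n
  (D ─ v) x with x ≟ᵛ v
  ... | yes _ = false
  ... | no  _ = D x

  module Removal (D : VSet m n) (v : Vertex m n) where

    ─-⊆ : ∀ x → x ∈ₛ (D ─ v) → x ∈ₛ D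
    ─-⊆ x x∈ with x ≟ᵛ v
    ... | no _ = x∈

    ─-removed : (D ─ v) v ≡ false
    ─-removed with v ≟ᵛ v
    ... | yes _   = refl
    ... | no  v≢v = ⊥-elim (v≢v refl)

    ─-∈ : ∀ {x} → x ∈ₛ D → ¬ x ≡ v → x ∈ₛ (D ─ v)
    ─-∈ {x} x∈ x≢v with x ≟ᵛ v
    ... | yes x≡v = ⊥-elim (x≢v x≡v)
    ... | no  _   = x∈

    ─-∈⊎≡ : ∀ {x} → x ∈ₛ D → x ∈ₛ (D ─ v) ⊎ x ≡ v
    ─-∈⊎≡ {x} x∈ with x ≟ᵛ v
    ... | yes x≡v = inj₂ x≡v
    ... | no  _   = inj₁ x∈

    ─-≢ : ∀ {x} → x ∈ₛ (D ─ v) → ¬ x ≡ v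
    ─-≢ x∈ refl with () ← trans (sym x∈) ─-removed

  source∈ : ∀ {E : BipEdges m n} {D x z} → PathIn E D x z → x ∈ₛ D
  source∈ (here x∈)     = x∈
  source∈ (step x∈ _ _) = x∈

module Redundant {m n} (E : BipEdges m n) (D : VSet m n) {i j : Fin m}
  (i≢j : ¬ i ≡ j) (i⊆j : i ⊆ᴺ[ E ] j)
  (i∈D : inj₁ i ∈ₛ D) (j∈D : inj₁ j ∈ₛ D) (cds : IsCDS E D) where

  D′ : VSet m n
  D′ = D ─ inj₁ i

  open Removal D (inj₁ i)

  j∈D′ : inj₁ j ∈ₛ D′
  j∈D′ = ─-∈ j∈D λ { refl → i≢j refl }

  W∈D′ : ∀ {w} → inj₂ w ∈ₛ D → inj₂ w ∈ₛ D′
  W∈D′ w∈ = ─-∈ w∈ λ ()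

  reroute : ∀ {x z} → PathIn E D x z → x ∈ₛ D′ → z ∈ₛ D′ → PathIn E D′ x z
  reroute (here _) x∈ _ = here x∈
  reroute (step _ x~y p) x∈ z∈ with ─-∈⊎≡ (source∈ p)
  ... | inj₁ y∈ = step x∈ x~y (reroute p y∈ z∈)
  reroute (step {x = inj₂ w} _ w~i (here _)) _ z∈ | inj₂ refl = ⊥-elim (─-≢ z∈ refl)
  reroute (step {x = inj₂ w} _ w~i (step {y = inj₂ w′} _ i~w′ p)) x∈ z∈ | inj₂ refl =
    step {y = inj₁ j} x∈ (i⊆j w w~i) (step j∈D′ (i⊆j w′ i~w′) (reroute p (W∈D′ (source∈ p)) z∈))

  connected′ : InducedConnected E D′
  connected′ x y x∈ y∈ = reroute (proj₁ cds x y (─-⊆ x x∈) (─-⊆ y y∈)) x∈ y∈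

  -- The first step of a walk from i to j in G[D] is a neighbour of i that survives in D′.
  neighbourOfRemoved : ∃ (λ v → v ∈ₛ D′ × Adj E (inj₁ i) v)
  neighbourOfRemoved with proj₁ cds (inj₁ i) (inj₁ j) i∈D j∈D
  ... | here _ = ⊥-elim (i≢j refl)
  ... | step {y = inj₂ w} _ i~w p = inj₂ w , W∈D′ (source∈ p) , i~w

  dominating′ : Dominating E D′
  dominating′ v with proj₂ cds v
  dominating′ v | inj₁ v∈ with ─-∈⊎≡ v∈
  ... | inj₁ v∈′  = inj₁ v∈′
  ... | inj₂ refl = inj₂ neighbourOfRemoved
  dominating′ v | inj₂ (u , u∈ , v~u) with ─-∈⊎≡ u∈
  ... | inj₁ u∈′ = inj₂ (u , u∈′ , v~u)
  dominating′ (inj₂ w) | inj₂ (_ , _ , w~i) | inj₂ refl = inj₂ (inj₁ j , j∈D′ , i⊆j w w~i)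

  isCDS′ : IsCDS E D′
  isCDS′ = connected′ , dominating′

  ¬minimal : ¬ IsMinimalCDS E D
  ¬minimal (_ , minimal) = minimal D′ (─-⊆ , inj₁ i , i∈D , ─-removed) isCDS′

mainTheorem4 : ∀ (m n : ℕ) → 2 ≤ m → 2 ≤ n →
    (E : BipEdges m n) → IsConvex E →
    (D : VSet m n) → IsMinimalCDS E D →
    (i j : Fin m) → ¬ (i ≡ j) →
    (∃ (λ w → IsRightEnd E i w × IsRightEnd E j w) ⊎ ∃ (λ w → IsLeftEnd E i w × IsLeftEnd E j w)) →
    ¬ (inj₁ i ∈ₛ D × inj₁ j ∈ₛ D)
mainTheorem4 m n _ _ E convex D minimal i j i≢j sharedEnd (i∈D , j∈D)
  with sharedEndpoint⇒nested E convex sharedEnd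
... | inj₁ i⊆j = Redundant.¬minimal E D i≢j i⊆j i∈D j∈D (proj₁ minimal) minimal
... | inj₂ j⊆i = Redundant.¬minimal E D (≢-sym i≢j) j⊆i j∈D i∈D (proj₁ minimal) minimal
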